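{- For any setfunction $\varphi$ on a set-algebra $(J,\mathcal{B})$, the quotient set $Q(\varphi)=\bigcup_{k\in\mathbb{N}}Q_k(\varphi)$ is quotient-closed and has the common lift property.
   Context: A setfunction on $(J,\mathcal{B})$ is a map $\varphi\colon\mathcal{B}\to\mathbb{R}$ with $\varphi(\emptyset)=0$. For $k\in\mathbb{N}$ and a measurable map $F\colon J\to[k]$, the quotient $\varphi\circ F^{ -1}$ is the setfunction on $2^{[k]}$ given by $A\mapsto\varphi(F^{ -1}(A))$; $Q_k(\varphi)$ is the set of all such quotients. A setfunction $\psi$ is a lift of $\psi'$ if $\psi'$ is a quotient of $\psi$. A family $A$ of finite setfunctions (i.e. setfunctions on $2^{[m]}$ for some $m$) is quotient-closed if every quotient of a function in $A$ lies in $A$, and has the common lift property if any finite set of functions in $A$ has a common lift in $A$. -}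

module Defs where

open import Data.Bool using (Bool; true; false; not; _∨_)
open import Data.Nat using (ℕ)
open import Data.Fin using (Fin)
open import Data.Unit using (⊤)
open import Data.Product using (Σ; Σ-syntax; _×_; proj₁; proj₂)
open import Data.List using (List)
open import Data.List.Relation.Unary.All using (All)
open import Function using (_∘_)
open import Relation.Binary.PropositionalEquality using (_≡_)

-- Subsets of J are represented by their characteristic functions J → Bool.

record SetAlgebra (J : Set) : Set₁ where
  field
    𝓑       : (J → Bool) → Set
    𝓑-ext   : ∀ {X Y : J → Bool} → (∀ j → X j ≡ Y j) → 𝓑 X → 𝓑 Y
    𝓑-∅     : 𝓑 (λ _ → false)
    𝓑-compl : ∀ {X} → 𝓑 X → 𝓑 (λ j → not (X j))
    𝓑-∪     : ∀ {X Y} → 𝓑 X → 𝓑 Y → 𝓑 (λ j → X j ∨ Y j)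

𝒫 : (k : ℕ) → SetAlgebra (Fin k)
𝒫 k = record
  { 𝓑 = λ _ → ⊤
  ; 𝓑-ext = λ _ _ → _
  ; 𝓑-∅ = _
  ; 𝓑-compl = λ _ → _
  ; 𝓑-∪ = λ _ _ → _
  }

-- A setfunction φ : 𝓑 → R with φ(∅) = 0 (values in a type R with a
-- distinguished zero; the paper uses R = ℝ).  φ is a function of the set,
-- i.e. it depends only on the subset (extensionally), not on the proof of
-- membership.
record SetFunction {J : Set} (𝒜 : SetAlgebra J) (R : Set) (0R : R) : Set where
  open SetAlgebra 𝒜
  field
    φ     : (X : J → Bool) → 𝓑 X → R
    φ-ext : ∀ {X Y} (p : 𝓑 X) (q : 𝓑 Y) → (∀ j → X j ≡ Y j) → φ X p ≡ φ Y q
    φ-∅   : φ (λ _ → false) 𝓑-∅ ≡ 0R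

_⁻¹[_] : {J : Set} {k : ℕ} → (J → Fin k) → (Fin k → Bool) → (J → Bool)
F ⁻¹[ A ] = A ∘ F

Measurable : {J : Set} (𝒜 : SetAlgebra J) {k : ℕ} → (J → Fin k) → Set
Measurable 𝒜 {k} F = (A : Fin k → Bool) → SetAlgebra.𝓑 𝒜 (F ⁻¹[ A ])

IsQuotient : {J : Set} {𝒜 : SetAlgebra J} {R : Set} {0R : R} →
             SetFunction 𝒜 R 0R → (k : ℕ) → SetFunction (𝒫 k) R 0R → Set
IsQuotient {J} {𝒜} φ k ψ =
  Σ[ F ∈ (J → Fin k) ] Σ[ mF ∈ Measurable 𝒜 F ]
    ((A : Fin k → Bool) (p : SetAlgebra.𝓑 (𝒫 k) A) →
       SetFunction.φ ψ A p ≡ SetFunction.φ φ (F ⁻¹[ A ]) (mF A))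

FinSetFunction : (R : Set) (0R : R) → Set
FinSetFunction R 0R = Σ[ m ∈ ℕ ] SetFunction (𝒫 m) R 0R

IsLiftOf : {R : Set} {0R : R} → FinSetFunction R 0R → FinSetFunction R 0R → Set
IsLiftOf ψ ψ' = IsQuotient (proj₂ ψ) (proj₁ ψ') (proj₂ ψ')

Q : {J : Set} {𝒜 : SetAlgebra J} {R : Set} {0R : R} →
    SetFunction 𝒜 R 0R → FinSetFunction R 0R → Set
Q φ ψ = IsQuotient φ (proj₁ ψ) (proj₂ ψ)

QuotientClosed : {R : Set} {0R : R} → (FinSetFunction R 0R → Set) → Set
QuotientClosed A = ∀ ψ ψ' → A ψ → IsLiftOf ψ ψ' → A ψ'

CommonLiftProperty : {R : Set} {0R : R} → (FinSetFunction R 0R → Set) → Set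
CommonLiftProperty {R} {0R} A =
  (L : List (FinSetFunction R 0R)) → All A L →
  Σ[ ψ ∈ FinSetFunction R 0R ] (A ψ × All (IsLiftOf ψ) L)

-- Composing two quotient maps gives a quotient map, so Q(φ) is quotient-closed.
-- Finitely many members φ ∘ F₁⁻¹, …, φ ∘ Fₙ⁻¹ of Q(φ) are all quotients of
-- φ ∘ H⁻¹ for the product map H = (F₁, …, Fₙ) : J → [k₁ ⋯ kₙ]. The product is
-- again measurable because (F, H)⁻¹(A) = ⋃ᵤ F⁻¹{u} ∩ H⁻¹{v | (u, v) ∈ A} is a
-- finite union of sets of 𝓑.
module Submission where

open import Defs
open import Data.Bool using (Bool; true; false; not; _∧_; _∨_)
open import Data.Bool.Properties using (∨-identityʳ; not-involutive)
open import Data.Nat using (ℕ; zero; suc; _*_)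
open import Data.Fin using (Fin; zero; suc; combine; remQuot)
open import Data.Fin.Properties using (_≟_; remQuot-combine)
open import Data.Vec.Functional using (foldr)
open import Data.Product using (Σ-syntax; _×_; _,_; proj₁; proj₂)
open import Data.List using (List; []; _∷_)
open import Data.List.Relation.Unary.All using (All; []; _∷_) renaming (map to All-map)
open import Data.Unit using (tt)
open import Function using (_∘_)
open import Relation.Nullary.Decidable using (does)
open import Relation.Binary.PropositionalEquality using (_≡_; refl; sym; trans; cong)

⋁ : ∀ {k} → (Fin k → Bool) → Bool
⋁ = foldr _∨_ false

⋁-false : ∀ k → ⋁ {k} (λ _ → false) ≡ false
⋁-false zero    = refl
⋁-false (suc k) = ⋁-false k

⋁-select : ∀ {k} (y : Fin k) (g : Fin k → Bool) → ⋁ (λ u → does (y ≟ u) ∧ g u) ≡ g y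
⋁-select {suc k} zero    g = trans (cong (g zero ∨_) (⋁-false k)) (∨-identityʳ (g zero))
⋁-select {suc k} (suc y) g = ⋁-select y (g ∘ suc)

module _ {J : Set} (𝒜 : SetAlgebra J) where
  open SetAlgebra 𝒜

  𝓑-const : (b : Bool) → 𝓑 (λ _ → b)
  𝓑-const false = 𝓑-∅
  𝓑-const true  = 𝓑-compl 𝓑-∅

  𝓑-∩ : ∀ {X Y} → 𝓑 X → 𝓑 Y → 𝓑 (λ j → X j ∧ Y j)
  𝓑-∩ {X} {Y} p q = 𝓑-ext (λ j → deMorgan (X j) (Y j)) (𝓑-compl (𝓑-∪ (𝓑-compl p) (𝓑-compl q)))
    where
    deMorgan : ∀ a b → not (not a ∨ not b) ≡ a ∧ b
    deMorgan true  b = not-involutive b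
    deMorgan false b = refl

  𝓑-⋁ : ∀ {k} (X : Fin k → J → Bool) → (∀ u → 𝓑 (X u)) → 𝓑 (λ j → ⋁ (λ u → X u j))
  𝓑-⋁ {zero}  X p = 𝓑-∅
  𝓑-⋁ {suc k} X p = 𝓑-∪ (p zero) (𝓑-⋁ (X ∘ suc) (p ∘ suc))

  -- The set {j | j ∈ X (F j)} is the union over u of F⁻¹{u} ∩ X u.
  𝓑-select : ∀ {k} {F : J → Fin k} → Measurable 𝒜 F →
             (X : Fin k → J → Bool) → (∀ u → 𝓑 (X u)) → 𝓑 (λ j → X (F j) j)
  𝓑-select {F = F} mF X p =
    𝓑-ext (λ j → ⋁-select (F j) (λ u → X u j))
          (𝓑-⋁ (λ u j → does (F j ≟ u) ∧ X u j) (λ u → 𝓑-∩ (mF (does ∘ (_≟ u))) (p u)))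

  Measurable-const : ∀ {k} (x : Fin k) → Measurable 𝒜 (λ _ → x)
  Measurable-const x A = 𝓑-const (A x)

  Measurable-combine : ∀ {a b} {F : J → Fin a} {H : J → Fin b} →
                       Measurable 𝒜 F → Measurable 𝒜 H →
                       Measurable 𝒜 (λ j → combine (F j) (H j))
  Measurable-combine {H = H} mF mH A =
    𝓑-select mF (λ u → H ⁻¹[ A ∘ combine u ]) (λ u → mH (A ∘ combine u))

IsQuotient-trans : ∀ {J} {𝒜 : SetAlgebra J} {R 0R} {φ : SetFunction 𝒜 R 0R}
                   {k} {ψ : SetFunction (𝒫 k) R 0R} {k'} {ψ' : SetFunction (𝒫 k') R 0R} →
                   IsQuotient φ k ψ → IsQuotient ψ k' ψ' → IsQuotient φ k' ψ'
IsQuotient-trans (F , mF , φ∘F⁻¹) (G , mG , ψ∘G⁻¹) =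
  G ∘ F , (λ A → mF (A ∘ G)) , λ A p → trans (ψ∘G⁻¹ A p) (φ∘F⁻¹ (A ∘ G) (mG A))

module _ {J : Set} {𝒜 : SetAlgebra J} {R : Set} {0R : R} (φ : SetFunction 𝒜 R 0R) where
  open SetFunction φ using (φ-ext; φ-∅)

  quotientBy : ∀ {k} (H : J → Fin k) → Measurable 𝒜 H → FinSetFunction R 0R
  quotientBy {k} H mH = k , record
    { φ     = λ A _ → SetFunction.φ φ (H ⁻¹[ A ]) (mH A)
    ; φ-ext = λ _ _ A≗B → φ-ext _ _ (A≗B ∘ H)
    ; φ-∅   = trans (φ-ext _ _ (λ _ → refl)) φ-∅
    }

  quotientBy∈Q : ∀ {k} (H : J → Fin k) (mH : Measurable 𝒜 H) → Q φ (quotientBy H mH)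
  quotientBy∈Q H mH = H , mH , λ _ _ → refl

  quotientBy-lifts : ∀ {k} (H : J → Fin k) (mH : Measurable 𝒜 H) {ψ} (q : Q φ ψ) →
                     (G : Fin k → Fin (proj₁ ψ)) → (∀ j → G (H j) ≡ proj₁ q j) →
                     IsLiftOf (quotientBy H mH) ψ
  quotientBy-lifts H mH (F , mF , φ∘F⁻¹) G G∘H≗F =
    G , (λ _ → tt) , λ A p → trans (φ∘F⁻¹ A p) (φ-ext _ _ (λ j → cong A (sym (G∘H≗F j))))

  commonRefinement : (L : List (FinSetFunction R 0R)) → All (Q φ) L →
                     Σ[ k ∈ ℕ ] Σ[ H ∈ (J → Fin k) ] Σ[ mH ∈ Measurable 𝒜 H ]
                       All (IsLiftOf (quotientBy H mH)) L
  commonRefinement [] [] = 1 , (λ _ → zero) , Measurable-const 𝒜 zero , []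
  commonRefinement ((a , ψ) ∷ L) (q@(F , mF , _) ∷ qs)
    with commonRefinement L qs
  ... | b , H , mH , lifts = a * b , F×H , mF×H , lift-ψ ∷ All-map (λ {ψ'} → lift-via-H {ψ'}) lifts
    where
    F×H : J → Fin (a * b)
    F×H j = combine (F j) (H j)

    mF×H : Measurable 𝒜 F×H
    mF×H = Measurable-combine 𝒜 mF mH

    lift-ψ : IsLiftOf (quotientBy F×H mF×H) (a , ψ)
    lift-ψ = quotientBy-lifts F×H mF×H {a , ψ} q (proj₁ ∘ remQuot b)
               (λ j → cong proj₁ (remQuot-combine (F j) (H j)))

    lift-H : IsLiftOf (quotientBy F×H mF×H) (quotientBy H mH)
    lift-H = quotientBy-lifts F×H mF×H {quotientBy H mH} (quotientBy∈Q H mH)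
               (proj₂ ∘ remQuot {a} b)
               (λ j → cong proj₂ (remQuot-combine (F j) (H j)))

    lift-via-H : ∀ {ψ'} → IsLiftOf (quotientBy H mH) ψ' → IsLiftOf (quotientBy F×H mF×H) ψ'
    lift-via-H {ψ'} = IsQuotient-trans {φ = proj₂ (quotientBy F×H mF×H)}
                        {ψ = proj₂ (quotientBy H mH)} {ψ' = proj₂ ψ'} lift-H

lemma2p4 : {J : Set} (𝒜 : SetAlgebra J) {R : Set} {0R : R} (φ : SetFunction 𝒜 R 0R) →
    QuotientClosed (Q φ) × CommonLiftProperty (Q φ)
lemma2p4 𝒜 φ = quotientClosed , commonLift
  where
  quotientClosed : QuotientClosed (Q φ)
  quotientClosed ψ ψ' = IsQuotient-trans {φ = φ} {ψ = proj₂ ψ} {ψ' = proj₂ ψ'}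

  commonLift : CommonLiftProperty (Q φ)
  commonLift L qs with commonRefinement φ L qs
  ... | _ , H , mH , lifts = quotientBy φ H mH , quotientBy∈Q φ H mH , lifts
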